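{- For each shrinking-causality event structure (SES) $\sigma$ there is an RCES $\rho$ such that $\sigma$ and $\rho$ are transition equivalent.
   Context: An SES is a tuple $\sigma=(E,\#,\to,\triangleright)$ with $E$ a set of events, $\#\subseteq E\times E$ irreflexive and symmetric, $\to\ \subseteq E\times E$ (initial causality), $\triangleright\subseteq E^3$; write $[c\to t]\triangleright d$ for $(c,t,d)\in\triangleright$ ($d$ drops the cause $c$ of $t$), required to imply $c\to t$. With $ic(e)=\{e'\mid e'\to e\}$ and $dc(H,e)=\{e'\mid\exists d\in H.\ [e'\to e]\triangleright d\}$: for $X,Y\subseteq E$, $X\to_s Y$ iff $X\subseteq Y$, $\neg(e\#e')$ for all $e,e'\in Y$, and $ic(e)\setminus dc(X,e)\subseteq X$ for all $e\in Y\setminus X$; $C(\sigma)$ is the set of subsets reachable from $\emptyset$ by finitely many $\to_s$-steps. An RCES is a pair $\rho=(E,\vdash)$ with $\vdash\ \subseteq 2^E\times 2^E$; $X\to_{rc}Y$ iff $X\subseteq Y$ and for every $Z\subseteq Y$ there is $W\subseteq X$ with $W\vdash Z$; $C(\rho)$ is the set of subsets reachable from $\emptyset$ by finitely many $\to_{rc}$-steps. Two such structures $\mu,\mu'$ are transition equivalent iff $C(\mu)=C(\mu')$ and for all $X,Y\in C(\mu)$, $X\to_\mu Y$ iff $X\to_{\mu'}Y$. -}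

module Defs where

open import Level using (0ℓ)
open import Data.Product using (Σ; ∃; _×_; _,_)
open import Data.Sum using (_⊎_)
open import Data.Empty using (⊥)
open import Relation.Nullary using (¬_)
open import Relation.Unary using (Pred; _∈_; _∉_; _⊆_; ∅)
open import Function.Bundles using (_⇔_)

Subset : Set → Set₁
Subset E = Pred E 0ℓ

record SES (E : Set) : Set₁ where
  field
    _#_   : E → E → Set
    _⟶_   : E → E → Set
    drop  : E → E → E → Set              -- drop c t d  means  [c → t] ▷ d
    #-irrefl : ∀ e → ¬ (e # e)
    #-sym    : ∀ e e' → e # e' → e' # e
    drop⇒⟶  : ∀ c t d → drop c t d → c ⟶ t

  ic : E → Subset E
  ic e e' = e' ⟶ e

  dc : Subset E → E → Subset E
  dc H e e' = Σ E λ d → (d ∈ H) × drop e' e d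

  step : Subset E → Subset E → Set
  step X Y = (X ⊆ Y)
           × (∀ {e e'} → e ∈ Y → e' ∈ Y → ¬ (e # e'))
           × (∀ {e} → e ∈ Y → e ∉ X →
                ∀ {e'} → e' ∈ ic e → e' ∉ dc X e → e' ∈ X)

record RCES (E : Set) : Set₁ where
  field
    _⊢_ : Subset E → Subset E → Set

  step : Subset E → Subset E → Set₁
  step X Y = (X ⊆ Y)
           × (∀ (Z : Subset E) → Z ⊆ Y → Σ (Subset E) λ W → (W ⊆ X) × (W ⊢ Z))

data Reachable {E : Set} {ℓ} (step : Subset E → Subset E → Set ℓ)
       : Subset E → Set (Level.suc 0ℓ Level.⊔ ℓ) where
  base : ∀ {X} → X ⊆ ∅ → Reachable step X
  next : ∀ {X Y} → Reachable step X → step X Y → Reachable step Y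

TransitionEquivalent : {E : Set} → SES E → RCES E → Set₁
TransitionEquivalent {E} σ ρ =
    (∀ (X : Subset E) → (Reachable (SES.step σ) X ⇔ Reachable (RCES.step ρ) X))
  × (∀ (X Y : Subset E) → Reachable (SES.step σ) X → Reachable (SES.step σ) Y →
       (SES.step σ X Y ⇔ RCES.step ρ X Y))

-- Read the SES transition condition as a relation between a
-- set W of already-occurred events and a set Z of events: W enables Z when
-- Z is conflict-free and every event of Z outside W has all of its initial
-- causes that are not dropped by W inside W.  Then X →s Y is literally
-- X ⊆ Y together with "X enables Y".  Take this enabling relation as the
-- RCES ⊢.  Enabling is antitone in the enabled set (so X →s Y gives
-- X →rc Y, choosing W = X for every Z ⊆ Y) and monotone in the enabling
-- set, because dropping a cause is monotone (so X →rc Y, applied to Z = Y,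
-- gives X →s Y).  Hence the two step relations coincide, and so do their
-- reachable sets by the general fact that reachability only depends on the
-- step relation up to logical equivalence.
module Submission where

open import Level using (Level)
open import Defs
open import Data.Product using (Σ; _×_; _,_)
open import Relation.Nullary using (¬_)
open import Relation.Unary using (_∈_; _∉_; _⊆_)
open import Function.Bundles using (_⇔_; mk⇔)

reachable-map : ∀ {E : Set} {ℓ ℓ' : Level}
                  {step : Subset E → Subset E → Set ℓ}
                  {step' : Subset E → Subset E → Set ℓ'} →
                (∀ {X Y} → step X Y → step' X Y) →
                ∀ {X} → Reachable step X → Reachable step' X
reachable-map f (base X⊆∅)  = base X⊆∅
reachable-map f (next r s)  = next (reachable-map f r) (f s)

module _ {E : Set} (σ : SES E) where
  open SES σ

  Enables : Subset E → Subset E → Set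
  Enables W Z = (∀ {e e'} → e ∈ Z → e' ∈ Z → ¬ (e # e'))
              × (∀ {e} → e ∈ Z → e ∉ W →
                   ∀ {e'} → e' ∈ ic e → e' ∉ dc W e → e' ∈ W)

  dc-mono : ∀ {W X} → W ⊆ X → ∀ {e} → dc W e ⊆ dc X e
  dc-mono W⊆X (d , d∈W , d-drops) = d , W⊆X d∈W , d-drops

  enables-antitone : ∀ {W Y Z} → Z ⊆ Y → Enables W Y → Enables W Z
  enables-antitone Z⊆Y (conflict-free , causes) =
      (λ e∈Z e'∈Z → conflict-free (Z⊆Y e∈Z) (Z⊆Y e'∈Z))
    , (λ e∈Z → causes (Z⊆Y e∈Z))

  -- A set enabled by W is enabled by any larger X ⊇ W: an undropped cause
  -- w.r.t. X is undropped w.r.t. W, hence lies in W ⊆ X.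
  enables-monotone : ∀ {W X Z} → W ⊆ X → Enables W Z → Enables X Z
  enables-monotone W⊆X (conflict-free , causes) =
    conflict-free , λ e∈Z e∉X e'∈ic e'∉dcX →
      W⊆X (causes e∈Z (λ e∈W → e∉X (W⊆X e∈W)) e'∈ic
                 (λ e'∈dcW → e'∉dcX (dc-mono W⊆X e'∈dcW)))

  -- The RCES whose enabling relation is Enables.  Note that  step X Y  unfolds
  -- definitionally to  (X ⊆ Y) × Enables X Y.
  ρ : RCES E
  ρ = record { _⊢_ = Enables }

  -- An SES step is an RCES step: every Z ⊆ Y is enabled by X itself.
  ses⇒rces : ∀ {X Y} → step X Y → RCES.step ρ X Y
  ses⇒rces (X⊆Y , X-enables-Y) =
    X⊆Y , λ Z Z⊆Y → _ , (λ x → x) , enables-antitone Z⊆Y X-enables-Y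

  -- An RCES step is an SES step: Y is enabled by some W ⊆ X, hence by X.
  rces⇒ses : ∀ {X Y} → RCES.step ρ X Y → step X Y
  rces⇒ses {Y = Y} (X⊆Y , enabled) with enabled Y (λ y → y)
  ... | _ , W⊆X , W-enables-Y = X⊆Y , enables-monotone W⊆X W-enables-Y

lemma8 : ∀ {E : Set} (σ : SES E) → Σ (RCES E) λ ρ → TransitionEquivalent σ ρ
lemma8 σ =
    ρ σ
  , (λ X → mk⇔ (reachable-map (ses⇒rces σ)) (reachable-map (rces⇒ses σ)))
  , (λ X Y _ _ → mk⇔ (ses⇒rces σ) (rces⇒ses σ))
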